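{- Let $a=(a_1,\ldots,a_n)$ be a weak composition with $k=a_1+\cdots+a_n$. Let $\tilde U_a$ be the filling of the diagram of $a$ obtained by filling its cells in order column by column from left to right, each column from bottom to top, with the entries $1,2,\ldots,n,1,2,\ldots,n,1,\ldots$ repeating cyclically. Then $\tilde U_a\in\mathrm{SSKD}(a)$ and $\mathrm{wt}(\tilde U_a)=\eta_{n,k}$.
   Context: Fix $n\ge 2$. A weak composition is $a=(a_1,\ldots,a_n)\in\mathbb{Z}_{\ge0}^n$. Its diagram has $a_r$ cells left-justified in row $r$ (row $1$ at the bottom), in columns $1,\dots,a_r$; there is also a basement column $0$ whose cell in row $r$ has entry $r$. A filling assigns an entry in $\{1,\ldots,n\}$ to each cell. A filling is non-attacking if no two cells with the same entry lie in the same column, and no two cells with the same entry lie in adjacent columns $c,c+1$ with the cell in column $c$ in a strictly higher row than the cell in column $c+1$. A triple consists of three cells (basement allowed): two cells in row $r$ in adjacent columns $c,c+1$, and a third cell either (Type I) in column $c$ in a row $s>r$ with $a_r>a_s$, or (Type II) in column $c+1$ in a row $s<r$ with $a_r\ge a_s$. Entries are compared as integers (basement entry = row index), equal entries being compared by regarding the one further right as smaller. For Type I let $\alpha,\beta,\gamma$ be the entries of the lower-left, lower-right, upper cell; for Type II of the upper-left, upper-right, lower cell. It is a co-inversion triple if $\alpha<\beta<\gamma$ or $\beta<\gamma<\alpha$ or $\gamma<\alpha<\beta$. $\mathrm{SSKD}(a)$ is the set of non-attacking fillings with no co-inversion triples. $\mathrm{wt}(T)\in\mathbb{Z}_{\ge0}^n$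 has $r$-th part equal to the number of entries of $T$ equal to $r$. Writing $k=mn+r$ with $m\ge0$ and $0\le r<n$, $\eta_{n,k}=(m+1,\ldots,m+1,m,\ldots,m)$ with $r$ parts equal to $m+1$ followed by $n-r$ parts equal to $m$. -}

module Defs where

open import Data.Nat using (ℕ; zero; suc; _+_; _∸_; _⊓_; _≤_; _<_; NonZero)
import Data.Nat as ℕ
open import Data.Nat.DivMod using (_%_; _/_; m%n<n)
open import Data.Fin using (Fin; toℕ; fromℕ<)
import Data.Fin as F
open import Data.Vec using (Vec; lookup; tabulate; sum)
open import Data.List using (List; upTo; map; filter; length)
open import Data.Product using (_×_; _,_)
open import Data.Sum using (_⊎_)
open import Relation.Binary.PropositionalEquality using (_≡_; _≢_)
open import Relation.Nullary using (¬_; Dec; yes; no)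

-- Conventions: rows 1..n are represented by Fin n (row r ↔ index with toℕ = r-1);
-- entries 1..n are likewise represented by Fin n (entry e ↔ toℕ = e-1), so the
-- basement cell of row r has entry r, i.e. the same Fin n element.
-- Columns are natural numbers; column 0 is the basement.

WeakComp : ℕ → Set
WeakComp n = Vec ℕ n

-- A filling: entry of the cell in row r, column c (only cells with
-- 1 ≤ c ≤ a_r are meaningful; other values are ignored).
Filling : ℕ → Set
Filling n = Fin n → ℕ → Fin n

entry : ∀ {n} → Filling n → Fin n → ℕ → Fin n
entry T r zero    = r
entry T r (suc c) = T r (suc c)

InDiag : ∀ {n} → WeakComp n → Fin n → ℕ → Set
InDiag a r c = c ≤ lookup a r

NonAttacking : ∀ {n} → WeakComp n → Filling n → Set
NonAttacking {n} a T =
  (∀ (r s : Fin n) (c : ℕ) → r ≢ s → InDiag a r c → InDiag a s c →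
      entry T r c ≢ entry T s c)
  × (∀ (r s : Fin n) (c : ℕ) → s F.< r → InDiag a r c → InDiag a s (suc c) →
      entry T r c ≢ entry T s (suc c))

EntLt : ∀ {n} → Fin n → ℕ → Fin n → ℕ → Set
EntLt x cx y cy = (toℕ x < toℕ y) ⊎ ((x ≡ y) × (cy < cx))

CoInv : ∀ {n} → Fin n → ℕ → Fin n → ℕ → Fin n → ℕ → Set
CoInv α cα β cβ γ cγ =
  (EntLt α cα β cβ × EntLt β cβ γ cγ)
  ⊎ (EntLt β cβ γ cγ × EntLt γ cγ α cα)
  ⊎ (EntLt γ cγ α cα × EntLt α cα β cβ)

NoCoInvTriples : ∀ {n} → WeakComp n → Filling n → Set
NoCoInvTriples {n} a T =
  (∀ (r s : Fin n) (c : ℕ) → r F.< s → lookup a s < lookup a r →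
      InDiag a r (suc c) → InDiag a s c →
      ¬ CoInv (entry T r c) c (entry T r (suc c)) (suc c) (entry T s c) c)
  × (∀ (r s : Fin n) (c : ℕ) → s F.< r → lookup a s ≤ lookup a r →
      InDiag a r (suc c) → InDiag a s (suc c) →
      ¬ CoInv (entry T r c) c (entry T r (suc c)) (suc c) (entry T s (suc c)) (suc c))

SSKD : ∀ {n} → WeakComp n → Filling n → Set
SSKD a T = NonAttacking a T × NoCoInvTriples a T

wt : ∀ {n} → WeakComp n → Filling n → Vec ℕ n
wt {n} a T = tabulate λ i → sum (tabulate λ (r : Fin n) →
  length (filter (λ c → T r c F.≟ i) (map suc (upTo (lookup a r)))))

ind : ∀ {P : Set} → Dec P → ℕ
ind (yes _) = 1
ind (no _)  = 0

-- 0-based position of cell (r, c), c ≥ 1, in the reading order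
-- "column by column left to right, each column bottom to top":
-- cells in columns 1..c-1, plus cells of column c in rows below r.
position : ∀ {n} → WeakComp n → Fin n → ℕ → ℕ
position {n} a r c =
  sum (tabulate λ (r' : Fin n) → lookup a r' ⊓ (c ∸ 1))
  + sum (tabulate λ (r' : Fin n) → ind (toℕ r' ℕ.<? toℕ r) ℕ.* ind (c ℕ.≤? lookup a r'))

U~ : ∀ {n} .{{_ : NonZero n}} → WeakComp n → Filling n
U~ {n} a r c = fromℕ< (m%n<n (position a r c) n)

η : (n : ℕ) .{{_ : NonZero n}} → ℕ → Vec ℕ n
η n k = tabulate λ (i : Fin n) → ind (toℕ i ℕ.<? (k % n)) + (k / n)

module Submission where

-- Read the diagram column by column, each column bottom to top, starting with the basement
-- column 0. The basement has n cells, so the entry of Ũ_a in every cell, basement included, is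
-- (reading index mod n) + 1. In each column the indices increase upwards, every index of a
-- column is smaller than every index of the next one, and a column has at most n cells. Hence
-- the two cells x, y of a potentially attacking pair have indices i(x) < i(y) < i(x) + n, and a
-- triple with lower-left cell x, lower-right cell z and third cell y has i(x) < i(y) < i(z) ≤
-- i(x) + n. Residues of a window of length n are pairwise distinct, and the residues of
-- i(x), i(y), i(z) then go round ℤ/n in the order x, y, z, whereas a co-inversion triple needs
-- the order x, z, y. Finally the non-basement cells carry the residues of 0, …, k − 1, and
-- exactly ⌊k/n⌋ + [e < k mod n] of these numbers are congruent to e.

open import Defs
open import Data.Nat using (ℕ; _≤_; NonZero)
open import Data.Vec using (Vec; sum)
open import Data.Product using (_×_)
open import Relation.Binary.PropositionalEquality using (_≡_)

open import Data.Nat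
  using (zero; suc; _+_; _*_; _∸_; _⊓_; _<_; z≤n; s≤s; s≤s⁻¹; _≟_; _<?_; _≤?_)
open import Data.Nat.Properties
open import Data.Nat.DivMod
  using (_%_; _/_; %-congˡ; m%n<n; m<n⇒m%n≡m; m≤n⇒[n∸m]%m≡n%m; [m+n]%n≡m%n; [m+kn]%n≡m%n;
         m≡m%n+[m/n]*n)
open import Data.Fin using (Fin; toℕ) renaming (zero to fzero; suc to fsuc)
import Data.Fin as F
open import Data.Fin.Properties using (toℕ-fromℕ<; toℕ-injective; toℕ<n)
open import Data.Vec using ([]; _∷_; lookup; tabulate)
open import Data.Vec.Properties using (tabulate-cong; tabulate∘lookup)
open import Data.List using (upTo; map; filter; length; applyUpTo)
open import Data.List.Properties using (map-upTo)
open import Data.Product using (_,_)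
open import Data.Sum using (_⊎_; inj₁; inj₂)
open import Function using (_∘_)
open import Relation.Binary using (tri<; tri≈; tri>)
open import Relation.Binary.PropositionalEquality
  using (refl; sym; trans; cong; cong₂; subst; subst₂; _≢_; ≢-sym; module ≡-Reasoning)
open import Relation.Nullary using (¬_; Dec; yes; no; contradiction)
open import Relation.Unary using (Decidable)
open import Algebra.Properties.CommutativeSemigroup +-commutativeSemigroup
  using (x∙yz≈y∙xz; xy∙z≈xz∙y)
open import Algebra.Properties.CommutativeMonoid.Sum +-0-commutativeMonoid
  using (sum-syntax; sum-cong-≗; sum-replicate-zero; ∑-distrib-+; ∑-comm)

ind-cong : ∀ {P Q : Set} (p : Dec P) (q : Dec Q) → (P → Q) → (Q → P) → ind p ≡ ind q
ind-cong (yes _) (yes _) _   _   = refl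
ind-cong (no _)  (no _)  _   _   = refl
ind-cong (yes p) (no ¬q) P→Q _   = contradiction (P→Q p) ¬q
ind-cong (no ¬p) (yes q) _   Q→P = contradiction (Q→P q) ¬p

ind-mono : ∀ {P Q : Set} (p : Dec P) (q : Dec Q) → (P → Q) → ind p ≤ ind q
ind-mono (yes _) (yes _) _   = ≤-refl
ind-mono (yes p) (no ¬q) P→Q = contradiction (P→Q p) ¬q
ind-mono (no _)  _       _   = z≤n

ind-yes : ∀ {P : Set} (p : Dec P) → P → ind p ≡ 1
ind-yes (yes _) _ = refl
ind-yes (no ¬p) p = contradiction p ¬p

ind-no : ∀ {P : Set} (p : Dec P) → ¬ P → ind p ≡ 0
ind-no (yes p) ¬p = contradiction p ¬p
ind-no (no _)  _  = refl

ind≤1 : ∀ {P : Set} (p : Dec P) → ind p ≤ 1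
ind≤1 (yes _) = ≤-refl
ind≤1 (no _)  = z≤n

-- sum-cong-≗ itself leaves its two vectors uninferred at the call sites below.
∑-cong : ∀ {l} {f g : Fin l → ℕ} → (∀ i → f i ≡ g i) → ∑[ i < l ] f i ≡ ∑[ i < l ] g i
∑-cong = sum-cong-≗

sum-tabulate : ∀ {l} (f : Fin l → ℕ) → sum (tabulate f) ≡ ∑[ i < l ] f i
sum-tabulate {zero}  f = refl
sum-tabulate {suc l} f = cong (f fzero +_) (sum-tabulate (f ∘ fsuc))

∑-suc : ∀ {l} (f : Fin l → ℕ) → ∑[ i < l ] suc (f i) ≡ l + ∑[ i < l ] f i
∑-suc {zero}  f = refl
∑-suc {suc l} f =
  cong suc (trans (cong (f fzero +_) (∑-suc (f ∘ fsuc))) (x∙yz≈y∙xz (f fzero) l _))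

∑-split : ∀ A {B} (f : ℕ → ℕ) →
          ∑[ j < A + B ] f (toℕ j) ≡ ∑[ j < A ] f (toℕ j) + ∑[ j < B ] f (A + toℕ j)
∑-split zero    f = refl
∑-split (suc A) f = trans (cong (f 0 +_) (∑-split A (f ∘ suc))) (sym (+-assoc (f 0) _ _))

∑-concat : ∀ (f N H : ℕ → ℕ) → (∀ j → N (suc j) ≡ N j + H j) → ∀ K →
           ∑[ p < N 0 ] f (toℕ p) + ∑[ j < K ] ∑[ p < H (toℕ j) ] f (N (toℕ j) + toℕ p)
             ≡ ∑[ p < N K ] f (toℕ p)
∑-concat f N H step zero    = +-identityʳ _
∑-concat f N H step (suc K) = begin
  S (N 0) + (∑[ p < H 0 ] f (N 0 + toℕ p) + R)  ≡⟨ +-assoc (S (N 0)) _ R ⟨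
  S (N 0) + ∑[ p < H 0 ] f (N 0 + toℕ p) + R    ≡⟨ cong (_+ R) (∑-split (N 0) f) ⟨
  S (N 0 + H 0) + R                              ≡⟨ cong (λ m → S m + R) (step 0) ⟨
  S (N 1) + R                                    ≡⟨ ∑-concat f (N ∘ suc) (H ∘ suc) (step ∘ suc) K ⟩
  S (N (suc K))                                  ∎
  where
  open ≡-Reasoning
  S : ℕ → ℕ
  S m = ∑[ p < m ] f (toℕ p)
  R : ℕ
  R = ∑[ j < K ] ∑[ p < H (suc (toℕ j)) ] f (N (suc (toℕ j)) + toℕ p)

∑-extend : ∀ (f : ℕ → ℕ) {m K} → m ≤ K →
           ∑[ j < m ] f (toℕ j) ≡ ∑[ j < K ] (ind (suc (toℕ j) ≤? m) * f (toℕ j))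
∑-extend f {m} {K} m≤K = begin
  ∑[ j < m ] f (toℕ j)                                 ≡⟨ ∑-cong inside ⟩
  ∑[ j < m ] g (toℕ j)                                 ≡⟨ +-identityʳ _ ⟨
  ∑[ j < m ] g (toℕ j) + 0                             ≡⟨ cong (∑[ j < m ] g (toℕ j) +_) outside ⟨
  ∑[ j < m ] g (toℕ j) + ∑[ j < K ∸ m ] g (m + toℕ j)  ≡⟨ ∑-split m g ⟨
  ∑[ j < m + (K ∸ m) ] g (toℕ j)
    ≡⟨ cong (λ L → ∑[ j < L ] g (toℕ j)) (m+[n∸m]≡n m≤K) ⟩
  ∑[ j < K ] g (toℕ j)                                 ∎
  where
  open ≡-Reasoning
  g : ℕ → ℕ
  g j = ind (suc j ≤? m) * f j
  inside : ∀ (j : Fin m) → f (toℕ j) ≡ g (toℕ j)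
  inside j =
    sym (trans (cong (_* f (toℕ j)) (ind-yes (suc (toℕ j) ≤? m) (toℕ<n j))) (+-identityʳ _))
  outside : ∑[ j < K ∸ m ] g (m + toℕ j) ≡ 0
  outside = trans
    (∑-cong λ (j : Fin (K ∸ m)) →
       cong (_* f (m + toℕ j)) (ind-no (suc (m + toℕ j) ≤? m) (≤⇒≯ (m≤m+n m (toℕ j)))))
    (sum-replicate-zero (K ∸ m))

∑-ind-≟ : ∀ I r → ∑[ p < r ] ind (toℕ p ≟ I) ≡ ind (I <? r)
∑-ind-≟ I       zero    = refl
∑-ind-≟ zero    (suc r) = cong suc (sum-replicate-zero r)
∑-ind-≟ (suc I) (suc r) = begin
  ∑[ p < r ] ind (suc (toℕ p) ≟ suc I)
    ≡⟨ ∑-cong (λ (p : Fin r) → ind-cong (suc (toℕ p) ≟ suc I) (toℕ p ≟ I) suc-injective (cong suc)) ⟩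
  ∑[ p < r ] ind (toℕ p ≟ I)  ≡⟨ ∑-ind-≟ I r ⟩
  ind (I <? r)                ≡⟨ ind-cong (I <? r) (suc I <? suc r) s≤s s≤s⁻¹ ⟩
  ind (suc I <? suc r)        ∎
  where open ≡-Reasoning

-- Residues

-- p, q, t are met in this order going round ℤ/n, where t = p is allowed.
data CyclicallyOrdered (p q t : ℕ) : Set where
  p<q<t : p < q → q < t → CyclicallyOrdered p q t
  q<t≤p : q < t → t ≤ p → CyclicallyOrdered p q t
  t≤p<q : t ≤ p → p < q → CyclicallyOrdered p q t

module _ (n : ℕ) .{{_ : NonZero n}} where

  %-shift : ∀ x d → (x + d) % n ≡ (x % n + d) % n
  %-shift x d = begin
    (x + d) % n                  ≡⟨ %-congˡ (cong (_+ d) (m≡m%n+[m/n]*n x n)) ⟩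
    (x % n + x / n * n + d) % n  ≡⟨ %-congˡ (xy∙z≈xz∙y (x % n) _ d) ⟩
    (x % n + d + x / n * n) % n  ≡⟨ [m+kn]%n≡m%n (x % n + d) (x / n) n ⟩
    (x % n + d) % n              ∎
    where open ≡-Reasoning

  %-periodic : ∀ q p → (q * n + p) % n ≡ p % n
  %-periodic q p = trans (%-congˡ (+-comm (q * n) p)) ([m+kn]%n≡m%n p q n)

  m%n+n≡m : ∀ {w} → n ≤ w → w < n + n → w % n + n ≡ w
  m%n+n≡m {w} n≤w w<n+n = begin
    w % n + n        ≡⟨ cong (_+ n) (m≤n⇒[n∸m]%m≡n%m n≤w) ⟨
    (w ∸ n) % n + n  ≡⟨ cong (_+ n) (m<n⇒m%n≡m (m<n+o⇒m∸n<o w n w<n+n)) ⟩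
    w ∸ n + n        ≡⟨ m∸n+n≡m n≤w ⟩
    w                ∎
    where open ≡-Reasoning

  %-window : ∀ {x y} → x ≤ y → y ≤ x + n →
             x % n + (y ∸ x) ≡ y % n ⊎ x % n + (y ∸ x) ≡ y % n + n
  %-window {x} {y} x≤y y≤x+n = wrapsOrNot (w <? n)
    where
    w : ℕ
    w = x % n + (y ∸ x)
    y%n≡w%n : y % n ≡ w % n
    y%n≡w%n = trans (%-congˡ (sym (m+[n∸m]≡n x≤y))) (%-shift x (y ∸ x))
    w<n+n : w < n + n
    w<n+n = +-mono-<-≤ (m%n<n x n) (m≤n+o⇒m∸n≤o y x y≤x+n)
    wrapsOrNot : Dec (w < n) → w ≡ y % n ⊎ w ≡ y % n + n
    wrapsOrNot (yes w<n) = inj₁ (sym (trans y%n≡w%n (m<n⇒m%n≡m w<n)))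
    wrapsOrNot (no w≮n)  =
      inj₂ (trans (sym (m%n+n≡m (≮⇒≥ w≮n) w<n+n)) (cong (_+ n) (sym y%n≡w%n)))

  %-distinct : ∀ {x y} → x < y → y < x + n → x % n ≢ y % n
  %-distinct {x} {y} x<y y<x+n x≡y with %-window (<⇒≤ x<y) (<⇒≤ y<x+n)
  ... | inj₁ e = <⇒≢ (m<m+n (x % n) (m<n⇒0<n∸m x<y)) (trans x≡y (sym e))
  ... | inj₂ e = <⇒≢ (+-monoʳ-< (x % n) (m<n+o⇒m∸n<o y x y<x+n))
                     (trans e (cong (_+ n) (sym x≡y)))

  %-cyclic : ∀ {x y z} → x < y → y < z → z ≤ x + n →
             CyclicallyOrdered (x % n) (y % n) (z % n)
  %-cyclic {x} {y} {z} x<y y<z z≤x+n =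
    cases (%-window (<⇒≤ x<y) (<⇒≤ (<-≤-trans y<z z≤x+n)))
          (%-window (<⇒≤ (<-trans x<y y<z)) z≤x+n)
    where
    u : ℕ
    u = x % n
    u<u+d : u < u + (y ∸ x)
    u<u+d = m<m+n u (m<n⇒0<n∸m x<y)
    u+d<u+D : u + (y ∸ x) < u + (z ∸ x)
    u+d<u+D = +-monoʳ-< u (∸-monoˡ-< y<z (<⇒≤ x<y))
    u+D≤u+n : u + (z ∸ x) ≤ u + n
    u+D≤u+n = +-monoʳ-≤ u (m≤n+o⇒m∸n≤o z x z≤x+n)
    cases : u + (y ∸ x) ≡ y % n ⊎ u + (y ∸ x) ≡ y % n + n →
            u + (z ∸ x) ≡ z % n ⊎ u + (z ∸ x) ≡ z % n + n →
            CyclicallyOrdered u (y % n) (z % n)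
    cases (inj₁ ey) (inj₁ ez) = p<q<t (subst (u <_) ey u<u+d) (subst₂ _<_ ey ez u+d<u+D)
    cases (inj₁ ey) (inj₂ ez) = t≤p<q (+-cancelʳ-≤ n _ _ (subst (_≤ u + n) ez u+D≤u+n))
                                      (subst (u <_) ey u<u+d)
    cases (inj₂ ey) (inj₂ ez) = q<t≤p (+-cancelʳ-< n _ _ (subst₂ _<_ ey ez u+d<u+D))
                                      (+-cancelʳ-≤ n _ _ (subst (_≤ u + n) ez u+D≤u+n))
    cases (inj₂ ey) (inj₁ ez) =
      contradiction (<-trans (subst₂ _<_ ey ez u+d<u+D) (m%n<n z n)) (≤⇒≯ (m≤n+m n (y % n)))

module ResidueCount (n : ℕ) .{{_ : NonZero n}} (I : ℕ) (I<n : I < n) where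

  δ : ℕ → ℕ
  δ p = ind (p % n ≟ I)

  ∑δ-shift : ∀ q L → ∑[ p < L ] δ (q * n + toℕ p) ≡ ∑[ p < L ] δ (toℕ p)
  ∑δ-shift q L = ∑-cong (λ (p : Fin L) → cong (λ v → ind (v ≟ I)) (%-periodic n q (toℕ p)))

  ∑δ-prefix : ∀ {r} → r ≤ n → ∑[ p < r ] δ (toℕ p) ≡ ind (I <? r)
  ∑δ-prefix {r} r≤n = trans
    (∑-cong (λ (p : Fin r) → cong (λ v → ind (v ≟ I)) (m<n⇒m%n≡m (<-≤-trans (toℕ<n p) r≤n))))
    (∑-ind-≟ I r)

  ∑δ-periods : ∀ q → ∑[ p < q * n ] δ (toℕ p) ≡ q
  ∑δ-periods zero    = refl
  ∑δ-periods (suc q) = begin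
    ∑[ p < n + q * n ] δ (toℕ p)
      ≡⟨ cong (λ L → ∑[ p < L ] δ (toℕ p)) (+-comm n (q * n)) ⟩
    ∑[ p < q * n + n ] δ (toℕ p)
      ≡⟨ ∑-split (q * n) δ ⟩
    ∑[ p < q * n ] δ (toℕ p) + ∑[ p < n ] δ (q * n + toℕ p)
      ≡⟨ cong₂ _+_ (∑δ-periods q) (∑δ-shift q n) ⟩
    q + ∑[ p < n ] δ (toℕ p)
      ≡⟨ cong (q +_) (trans (∑δ-prefix ≤-refl) (ind-yes (I <? n) I<n)) ⟩
    q + 1
      ≡⟨ +-comm q 1 ⟩
    suc q
      ∎
    where open ≡-Reasoning

  ∑δ : ∀ k → ∑[ p < k ] δ (toℕ p) ≡ ind (I <? k % n) + k / n
  ∑δ k = begin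
    ∑[ p < k ] δ (toℕ p)
      ≡⟨ cong (λ L → ∑[ p < L ] δ (toℕ p)) k≡q*n+r ⟩
    ∑[ p < k / n * n + k % n ] δ (toℕ p)
      ≡⟨ ∑-split (k / n * n) δ ⟩
    ∑[ p < k / n * n ] δ (toℕ p) + ∑[ p < k % n ] δ (k / n * n + toℕ p)
      ≡⟨ cong₂ _+_ (∑δ-periods (k / n)) (∑δ-shift (k / n) (k % n)) ⟩
    k / n + ∑[ p < k % n ] δ (toℕ p)
      ≡⟨ cong (k / n +_) (∑δ-prefix (<⇒≤ (m%n<n k n))) ⟩
    k / n + ind (I <? k % n)
      ≡⟨ +-comm (k / n) _ ⟩
    ind (I <? k % n) + k / n
      ∎
    where
    open ≡-Reasoning
    k≡q*n+r : k ≡ k / n * n + k % n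
    k≡q*n+r = trans (m≡m%n+[m/n]*n k n) (+-comm (k % n) _)

-- Co-inversion triples

>⇒¬EntLt : ∀ {m} {x y : Fin m} {cx cy} → toℕ y < toℕ x → ¬ EntLt x cx y cy
>⇒¬EntLt y<x (inj₁ x<y)        = <-asym x<y y<x
>⇒¬EntLt y<x (inj₂ (refl , _)) = <-irrefl refl y<x

≥⇒¬EntLt-suc : ∀ {m} {x y : Fin m} {c} → toℕ y ≤ toℕ x → ¬ EntLt x c y (suc c)
≥⇒¬EntLt-suc y≤x (inj₁ x<y)         = <⇒≱ x<y y≤x
≥⇒¬EntLt-suc _   (inj₂ (_ , c+1<c)) = <-asym c+1<c (n<1+n _)

-- A co-inversion triple has (α, β, γ) cyclically increasing; here it is (α, γ, β), and in a
-- tie between α and β the right-hand β counts as the smaller one.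
cyclic⇒¬CoInv : ∀ {m} {α β γ : Fin m} {c cγ p q t} → toℕ α ≡ p → toℕ γ ≡ q → toℕ β ≡ t →
                CyclicallyOrdered p q t → ¬ CoInv α c β (suc c) γ cγ
cyclic⇒¬CoInv refl refl refl (p<q<t α<γ γ<β) (inj₁ (_ , β<γ))        = >⇒¬EntLt γ<β β<γ
cyclic⇒¬CoInv refl refl refl (p<q<t α<γ γ<β) (inj₂ (inj₁ (β<γ , _))) = >⇒¬EntLt γ<β β<γ
cyclic⇒¬CoInv refl refl refl (p<q<t α<γ γ<β) (inj₂ (inj₂ (γ<α , _))) = >⇒¬EntLt α<γ γ<α
cyclic⇒¬CoInv refl refl refl (q<t≤p γ<β β≤α) (inj₁ (α<β , _))        = ≥⇒¬EntLt-suc β≤α α<β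
cyclic⇒¬CoInv refl refl refl (q<t≤p γ<β β≤α) (inj₂ (inj₁ (β<γ , _))) = >⇒¬EntLt γ<β β<γ
cyclic⇒¬CoInv refl refl refl (q<t≤p γ<β β≤α) (inj₂ (inj₂ (_ , α<β))) = ≥⇒¬EntLt-suc β≤α α<β
cyclic⇒¬CoInv refl refl refl (t≤p<q β≤α α<γ) (inj₁ (α<β , _))        = ≥⇒¬EntLt-suc β≤α α<β
cyclic⇒¬CoInv refl refl refl (t≤p<q β≤α α<γ) (inj₂ (inj₁ (_ , γ<α))) = >⇒¬EntLt α<γ γ<α
cyclic⇒¬CoInv refl refl refl (t≤p<q β≤α α<γ) (inj₂ (inj₂ (γ<α , _))) = >⇒¬EntLt α<γ γ<α

-- Columns of a diagram (basement included: cell (r, c) exists iff c ≤ a r)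

cellsBelow : ∀ {l} → Vec ℕ l → Fin l → ℕ → ℕ
cellsBelow (x ∷ xs) fzero    c = 0
cellsBelow (x ∷ xs) (fsuc r) c = ind (c ≤? x) + cellsBelow xs r c

columnHeight : ∀ {l} → Vec ℕ l → ℕ → ℕ
columnHeight {l} a c = ∑[ r < l ] ind (c ≤? lookup a r)

cellsBelow-as-sum : ∀ {l} (a : Vec ℕ l) r c →
  ∑[ r' < l ] (ind (toℕ r' <? toℕ r) * ind (c ≤? lookup a r')) ≡ cellsBelow a r c
cellsBelow-as-sum {suc l} (x ∷ xs) fzero    c = sum-replicate-zero (suc l)
cellsBelow-as-sum {suc l} (x ∷ xs) (fsuc r) c = cong₂ _+_ (+-identityʳ _) (begin
  ∑[ r' < l ] (ind (suc (toℕ r') <? suc (toℕ r)) * ind (c ≤? lookup xs r'))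
    ≡⟨ ∑-cong (λ r' → cong (_* ind (c ≤? lookup xs r'))
                            (ind-cong (suc (toℕ r') <? suc (toℕ r)) (toℕ r' <? toℕ r) s≤s⁻¹ s≤s)) ⟩
  ∑[ r' < l ] (ind (toℕ r' <? toℕ r) * ind (c ≤? lookup xs r'))
    ≡⟨ cellsBelow-as-sum xs r c ⟩
  cellsBelow xs r c
    ∎)
  where open ≡-Reasoning

cellsBelow-zero : ∀ {l} (a : Vec ℕ l) r → cellsBelow a r 0 ≡ toℕ r
cellsBelow-zero (x ∷ xs) fzero    = refl
cellsBelow-zero (x ∷ xs) (fsuc r) = cong suc (cellsBelow-zero xs r)

cellsBelow-< : ∀ {l} (a : Vec ℕ l) {r s} c → toℕ r < toℕ s → c ≤ lookup a r →
               cellsBelow a r c < cellsBelow a s c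
cellsBelow-< (x ∷ xs) {fzero}  {fsuc s} c _   c≤x rewrite ind-yes (c ≤? x) c≤x = s≤s z≤n
cellsBelow-< (x ∷ xs) {fsuc r} {fsuc s} c r<s c≤  =
  +-monoʳ-< (ind (c ≤? x)) (cellsBelow-< xs c (s≤s⁻¹ r<s) c≤)

cellsBelow<columnHeight : ∀ {l} (a : Vec ℕ l) r c → c ≤ lookup a r →
                          cellsBelow a r c < columnHeight a c
cellsBelow<columnHeight (x ∷ xs) fzero    c c≤x rewrite ind-yes (c ≤? x) c≤x = s≤s z≤n
cellsBelow<columnHeight (x ∷ xs) (fsuc r) c c≤  =
  +-monoʳ-< (ind (c ≤? x)) (cellsBelow<columnHeight xs r c c≤)

cellsBelow-suc≤ : ∀ {l} (a : Vec ℕ l) r c → cellsBelow a r (suc c) ≤ cellsBelow a r c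
cellsBelow-suc≤ (x ∷ xs) fzero    c = z≤n
cellsBelow-suc≤ (x ∷ xs) (fsuc r) c =
  +-mono-≤ (ind-mono (suc c ≤? x) (c ≤? x) (≤-trans (n≤1+n c))) (cellsBelow-suc≤ xs r c)

columnHeight≤ : ∀ {l} (a : Vec ℕ l) c → columnHeight a c ≤ l
columnHeight≤ []       c = z≤n
columnHeight≤ (x ∷ xs) c = +-mono-≤ (ind≤1 (c ≤? x)) (columnHeight≤ xs c)

∑-column : ∀ {l} (a : Vec ℕ l) c (f : ℕ → ℕ) →
  ∑[ r < l ] (ind (c ≤? lookup a r) * f (cellsBelow a r c)) ≡ ∑[ p < columnHeight a c ] f (toℕ p)
∑-column []       c f = refl
∑-column (x ∷ xs) c f =
  trans (cong (ind (c ≤? x) * f 0 +_) (∑-column xs c (f ∘ (ind (c ≤? x) +_)))) (prepend (c ≤? x))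
  where
  prepend : ∀ {P : Set} (d : Dec P) →
    ind d * f 0 + ∑[ p < columnHeight xs c ] f (ind d + toℕ p)
      ≡ ∑[ p < ind d + columnHeight xs c ] f (toℕ p)
  prepend (yes _) = cong (_+ ∑[ p < columnHeight xs c ] f (suc (toℕ p))) (+-identityʳ (f 0))
  prepend (no _)  = refl

cellsInFirstColumns : ∀ {l} → (Fin l → ℕ) → ℕ → ℕ
cellsInFirstColumns {l} len c = ∑[ r < l ] (len r ⊓ c)

⊓-suc : ∀ m c → m ⊓ suc c ≡ m ⊓ c + ind (suc c ≤? m)
⊓-suc m c with suc c ≤? m
... | yes c<m = begin
  m ⊓ suc c  ≡⟨ m≥n⇒m⊓n≡n c<m ⟩
  suc c      ≡⟨ +-comm 1 c ⟩
  c + 1      ≡⟨ cong (_+ 1) (m≥n⇒m⊓n≡n (<⇒≤ c<m)) ⟨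
  m ⊓ c + 1  ∎
  where open ≡-Reasoning
... | no c≮m = begin
  m ⊓ suc c  ≡⟨ m≤n⇒m⊓n≡m (<⇒≤ m<1+c) ⟩
  m          ≡⟨ m≤n⇒m⊓n≡m (s≤s⁻¹ m<1+c) ⟨
  m ⊓ c      ≡⟨ +-identityʳ _ ⟨
  m ⊓ c + 0  ∎
  where
  open ≡-Reasoning
  m<1+c : m < suc c
  m<1+c = ≰⇒> c≮m

cellsInFirstColumns-zero : ∀ {l} (len : Fin l → ℕ) → cellsInFirstColumns len 0 ≡ 0
cellsInFirstColumns-zero {l} len = trans (∑-cong (λ r → ⊓-zeroʳ (len r))) (sum-replicate-zero l)

cellsInFirstColumns-suc : ∀ {l} (len : Fin l → ℕ) c →
  cellsInFirstColumns len (suc c) ≡ cellsInFirstColumns len c + ∑[ r < l ] ind (suc c ≤? len r)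
cellsInFirstColumns-suc len c = trans (∑-cong (λ r → ⊓-suc (len r) c))
                                      (∑-distrib-+ (λ r → len r ⊓ c) (λ r → ind (suc c ≤? len r)))

cellsInFirstColumns-all : ∀ {l} (len : Fin l → ℕ) {c} → (∀ r → len r ≤ c) →
  cellsInFirstColumns len c ≡ ∑[ r < l ] len r
cellsInFirstColumns-all len len≤c = ∑-cong (λ r → m≤n⇒m⊓n≡m (len≤c r))

lookup≤sum : ∀ {l} (v : Vec ℕ l) r → lookup v r ≤ sum v
lookup≤sum (x ∷ xs) fzero    = m≤m+n x (sum xs)
lookup≤sum (x ∷ xs) (fsuc r) = ≤-trans (lookup≤sum xs r) (m≤n+m (sum xs) x)

-- 0-based index of cell (r, c) when the diagram, basement column included, is read column by
-- column, each column bottom to top; row r has the cells in columns 0, …, a r.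
readingIndex : ∀ {l} → Vec ℕ l → Fin l → ℕ → ℕ
readingIndex a r c = cellsInFirstColumns (suc ∘ lookup a) c + cellsBelow a r c

module _ {l} (a : Vec ℕ l) where

  private
    L : ℕ → ℕ
    L = cellsInFirstColumns (suc ∘ lookup a)

  readingIndex-suc : ∀ r c →
    readingIndex a r (suc c) ≡ L c + columnHeight a c + cellsBelow a r (suc c)
  readingIndex-suc r c = cong (_+ cellsBelow a r (suc c)) (begin
    L (suc c)
      ≡⟨ cellsInFirstColumns-suc (suc ∘ lookup a) c ⟩
    L c + ∑[ r' < l ] ind (suc c ≤? suc (lookup a r'))
      ≡⟨ cong (L c +_) (∑-cong (λ r' →
           ind-cong (suc c ≤? suc (lookup a r')) (c ≤? lookup a r') s≤s⁻¹ s≤s)) ⟩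
    L c + columnHeight a c
      ∎)
    where open ≡-Reasoning

  readingIndex-<-row : ∀ {r s} c → toℕ r < toℕ s → c ≤ lookup a r →
                       readingIndex a r c < readingIndex a s c
  readingIndex-<-row c r<s r∈ = +-monoʳ-< (L c) (cellsBelow-< a c r<s r∈)

  readingIndex-<-suc : ∀ {r s c} → c ≤ lookup a r → readingIndex a r c < readingIndex a s (suc c)
  readingIndex-<-suc {r} {s} {c} r∈ = begin-strict
    L c + cellsBelow a r c                           <⟨ +-monoʳ-< (L c) (cellsBelow<columnHeight a r c r∈) ⟩
    L c + columnHeight a c                           ≤⟨ m≤m+n _ _ ⟩
    L c + columnHeight a c + cellsBelow a s (suc c)  ≡⟨ readingIndex-suc s c ⟨
    readingIndex a s (suc c)                         ∎
    where open ≤-Reasoning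

  readingIndex-<-+rows : ∀ {r s c} → c ≤ lookup a s → readingIndex a s c < readingIndex a r c + l
  readingIndex-<-+rows {r} {s} {c} s∈ = begin-strict
    L c + cellsBelow a s c      <⟨ +-monoʳ-< (L c) (cellsBelow<columnHeight a s c s∈) ⟩
    L c + columnHeight a c      ≤⟨ +-monoʳ-≤ (L c) (columnHeight≤ a c) ⟩
    L c + l                     ≤⟨ +-monoˡ-≤ l (m≤m+n (L c) _) ⟩
    L c + cellsBelow a r c + l  ∎
    where open ≤-Reasoning

  readingIndex-suc≤+rows : ∀ r c → readingIndex a r (suc c) ≤ readingIndex a r c + l
  readingIndex-suc≤+rows r c = begin
    readingIndex a r (suc c)
      ≡⟨ readingIndex-suc r c ⟩
    L c + columnHeight a c + cellsBelow a r (suc c)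
      ≤⟨ +-mono-≤ (+-monoʳ-≤ (L c) (columnHeight≤ a c)) (cellsBelow-suc≤ a r c) ⟩
    L c + l + cellsBelow a r c
      ≡⟨ xy∙z≈xz∙y (L c) l _ ⟩
    L c + cellsBelow a r c + l
      ∎
    where open ≤-Reasoning

  position-suc : ∀ r c →
    position a r (suc c) ≡ cellsInFirstColumns (lookup a) c + cellsBelow a r (suc c)
  position-suc r c = cong₂ _+_
    (sum-tabulate (λ r' → lookup a r' ⊓ c))
    (trans (sum-tabulate (λ r' → ind (toℕ r' <? toℕ r) * ind (suc c ≤? lookup a r')))
           (cellsBelow-as-sum a r (suc c)))

  readingIndex-suc≡rows+position : ∀ r c → readingIndex a r (suc c) ≡ l + position a r (suc c)
  readingIndex-suc≡rows+position r c = begin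
    L (suc c) + cellsBelow a r (suc c)
      ≡⟨ cong (_+ cellsBelow a r (suc c)) (∑-suc (λ r' → lookup a r' ⊓ c)) ⟩
    l + cellsInFirstColumns (lookup a) c + cellsBelow a r (suc c)
      ≡⟨ +-assoc l _ _ ⟩
    l + (cellsInFirstColumns (lookup a) c + cellsBelow a r (suc c))
      ≡⟨ cong (l +_) (position-suc r c) ⟨
    l + position a r (suc c)
      ∎
    where open ≡-Reasoning

  cellsInFirstColumns-sum : cellsInFirstColumns (lookup a) (sum a) ≡ sum a
  cellsInFirstColumns-sum = begin
    cellsInFirstColumns (lookup a) (sum a)  ≡⟨ cellsInFirstColumns-all (lookup a) (lookup≤sum a) ⟩
    ∑[ r < l ] lookup a r                   ≡⟨ sum-tabulate (lookup a) ⟨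
    sum (tabulate (lookup a))               ≡⟨ cong sum (tabulate∘lookup a) ⟩
    sum a                                   ∎
    where open ≡-Reasoning

  -- Swap to summing column by column: the cells of column j + 1 occupy the consecutive
  -- positions N j, …, N (j + 1) − 1.
  ∑-positions : ∀ (f : ℕ → ℕ) →
    ∑[ r < l ] ∑[ j < lookup a r ] f (position a r (suc (toℕ j))) ≡ ∑[ p < sum a ] f (toℕ p)
  ∑-positions f = begin
    ∑[ r < l ] ∑[ j < lookup a r ] f (position a r (suc (toℕ j)))
      ≡⟨ ∑-cong (λ r → ∑-cong (λ (j : Fin (lookup a r)) → cong f (position-suc r (toℕ j)))) ⟩
    ∑[ r < l ] ∑[ j < lookup a r ] g r (toℕ j)
      ≡⟨ ∑-cong (λ r → ∑-extend (g r) (lookup≤sum a r)) ⟩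
    ∑[ r < l ] ∑[ j < k ] (ind (suc (toℕ j) ≤? lookup a r) * g r (toℕ j))
      ≡⟨ ∑-comm (λ (r : Fin l) (j : Fin k) → ind (suc (toℕ j) ≤? lookup a r) * g r (toℕ j)) ⟩
    ∑[ j < k ] ∑[ r < l ] (ind (suc (toℕ j) ≤? lookup a r) * g r (toℕ j))
      ≡⟨ ∑-cong (λ (j : Fin k) → ∑-column a (suc (toℕ j)) (λ p → f (N (toℕ j) + p))) ⟩
    columns
      ≡⟨ cong (λ m → ∑[ p < m ] f (toℕ p) + columns) (cellsInFirstColumns-zero (lookup a)) ⟨
    ∑[ p < N 0 ] f (toℕ p) + columns
      ≡⟨ ∑-concat f N (λ j → columnHeight a (suc j)) (cellsInFirstColumns-suc (lookup a)) k ⟩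
    ∑[ p < N k ] f (toℕ p)
      ≡⟨ cong (λ m → ∑[ p < m ] f (toℕ p)) cellsInFirstColumns-sum ⟩
    ∑[ p < k ] f (toℕ p)
      ∎
    where
    open ≡-Reasoning
    k : ℕ
    k = sum a
    N : ℕ → ℕ
    N = cellsInFirstColumns (lookup a)
    g : Fin l → ℕ → ℕ
    g r j = f (N j + cellsBelow a r (suc j))
    columns : ℕ
    columns = ∑[ j < k ] ∑[ p < columnHeight a (suc (toℕ j)) ] f (N (toℕ j) + toℕ p)

length-filter-applyUpTo : ∀ {P : ℕ → Set} (P? : Decidable P) (g : ℕ → ℕ) m →
  length (filter P? (applyUpTo g m)) ≡ ∑[ j < m ] ind (P? (g (toℕ j)))
length-filter-applyUpTo P? g zero = refl
length-filter-applyUpTo P? g (suc m) with P? (g 0)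
... | yes _ = cong suc (length-filter-applyUpTo P? (g ∘ suc) m)
... | no  _ = length-filter-applyUpTo P? (g ∘ suc) m

-- The filling Ũ_a

module _ {n : ℕ} .{{_ : NonZero n}} (a : WeakComp n) where

  toℕ-U~ : ∀ r c → toℕ (entry (U~ a) r c) ≡ readingIndex a r c % n
  toℕ-U~ r zero = sym (begin
    (cellsInFirstColumns (suc ∘ lookup a) 0 + cellsBelow a r 0) % n
      ≡⟨ %-congˡ (cong₂ _+_ (cellsInFirstColumns-zero (suc ∘ lookup a)) (cellsBelow-zero a r)) ⟩
    toℕ r % n
      ≡⟨ m<n⇒m%n≡m (toℕ<n r) ⟩
    toℕ r
      ∎)
    where open ≡-Reasoning
  toℕ-U~ r (suc c) = begin
    toℕ (U~ a r (suc c))            ≡⟨ toℕ-fromℕ< (m%n<n (position a r (suc c)) n) ⟩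
    position a r (suc c) % n        ≡⟨ [m+n]%n≡m%n _ n ⟨
    (position a r (suc c) + n) % n  ≡⟨ %-congˡ (+-comm _ n) ⟩
    (n + position a r (suc c)) % n  ≡⟨ %-congˡ (readingIndex-suc≡rows+position a r c) ⟨
    readingIndex a r (suc c) % n    ∎
    where open ≡-Reasoning

  U~-≢ : ∀ r s c c' → readingIndex a r c < readingIndex a s c' →
         readingIndex a s c' < readingIndex a r c + n → entry (U~ a) r c ≢ entry (U~ a) s c'
  U~-≢ r s c c' x<y y<x+n e = %-distinct n x<y y<x+n (begin
    readingIndex a r c % n   ≡⟨ toℕ-U~ r c ⟨
    toℕ (entry (U~ a) r c)   ≡⟨ cong toℕ e ⟩
    toℕ (entry (U~ a) s c')  ≡⟨ toℕ-U~ s c' ⟩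
    readingIndex a s c' % n  ∎)
    where open ≡-Reasoning

  U~-¬CoInv : ∀ r s c c' → readingIndex a r c < readingIndex a s c' →
              readingIndex a s c' < readingIndex a r (suc c) →
              ¬ CoInv (entry (U~ a) r c) c (entry (U~ a) r (suc c)) (suc c) (entry (U~ a) s c') c'
  U~-¬CoInv r s c c' x<y y<z =
    cyclic⇒¬CoInv (toℕ-U~ r c) (toℕ-U~ s c') (toℕ-U~ r (suc c))
                  (%-cyclic n x<y y<z (readingIndex-suc≤+rows a r c))

  U~-nonAttacking : NonAttacking a (U~ a)
  U~-nonAttacking = sameColumn , adjacentColumns
    where
    sameColumn : ∀ r s c → r ≢ s → InDiag a r c → InDiag a s c →
                 entry (U~ a) r c ≢ entry (U~ a) s c
    sameColumn r s c r≢s r∈ s∈ with <-cmp (toℕ r) (toℕ s)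
    ... | tri< r<s _ _ = U~-≢ r s c c (readingIndex-<-row a c r<s r∈) (readingIndex-<-+rows a s∈)
    ... | tri≈ _ r≡s _ = contradiction (toℕ-injective r≡s) r≢s
    ... | tri> _ _ s<r =
      ≢-sym (U~-≢ s r c c (readingIndex-<-row a c s<r s∈) (readingIndex-<-+rows a r∈))
    adjacentColumns : ∀ r s c → s F.< r → InDiag a r c → InDiag a s (suc c) →
                      entry (U~ a) r c ≢ entry (U~ a) s (suc c)
    adjacentColumns r s c s<r r∈ s∈ = U~-≢ r s c (suc c) (readingIndex-<-suc a r∈)
      (≤-<-trans (readingIndex-suc≤+rows a s c)
                 (+-monoˡ-< n (readingIndex-<-row a c s<r (≤-trans (n≤1+n c) s∈))))

  U~-noCoInvTriples : NoCoInvTriples a (U~ a)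
  U~-noCoInvTriples = typeI , typeII
    where
    typeI : ∀ r s c → r F.< s → lookup a s < lookup a r → InDiag a r (suc c) → InDiag a s c →
            ¬ CoInv (entry (U~ a) r c) c (entry (U~ a) r (suc c)) (suc c) (entry (U~ a) s c) c
    typeI r s c r<s _ r∈ s∈ =
      U~-¬CoInv r s c c (readingIndex-<-row a c r<s (≤-trans (n≤1+n c) r∈))
                        (readingIndex-<-suc a s∈)
    typeII : ∀ r s c → s F.< r → lookup a s ≤ lookup a r → InDiag a r (suc c) →
             InDiag a s (suc c) →
             ¬ CoInv (entry (U~ a) r c) c (entry (U~ a) r (suc c)) (suc c)
                     (entry (U~ a) s (suc c)) (suc c)
    typeII r s c s<r _ r∈ s∈ =
      U~-¬CoInv r s c (suc c) (readingIndex-<-suc a (≤-trans (n≤1+n c) r∈))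
                              (readingIndex-<-row a (suc c) s<r s∈)

  U~-SSKD : SSKD a (U~ a)
  U~-SSKD = U~-nonAttacking , U~-noCoInvTriples

  U~-count : ∀ i →
    sum (tabulate λ r → length (filter (λ c → U~ a r c F.≟ i) (map suc (upTo (lookup a r)))))
      ≡ ind (toℕ i <? sum a % n) + sum a / n
  U~-count i = begin
    sum (tabulate λ r → length (filter (P? r) (map suc (upTo (lookup a r)))))
      ≡⟨ sum-tabulate (λ r → length (filter (P? r) (map suc (upTo (lookup a r))))) ⟩
    ∑[ r < n ] length (filter (P? r) (map suc (upTo (lookup a r))))
      ≡⟨ ∑-cong rowCount ⟩
    ∑[ r < n ] ∑[ j < lookup a r ] δ (position a r (suc (toℕ j)))
      ≡⟨ ∑-positions a δ ⟩
    ∑[ p < sum a ] δ (toℕ p)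
      ≡⟨ ∑δ (sum a) ⟩
    ind (toℕ i <? sum a % n) + sum a / n
      ∎
    where
    open ResidueCount n (toℕ i) (toℕ<n i)
    open ≡-Reasoning
    P? : ∀ r → Decidable (λ c → U~ a r c ≡ i)
    P? r c = U~ a r c F.≟ i
    δ-position : ∀ r c → ind (P? r c) ≡ δ (position a r c)
    δ-position r c = ind-cong (P? r c) (position a r c % n ≟ toℕ i)
      (λ e → trans (sym (toℕ-fromℕ< (m%n<n (position a r c) n))) (cong toℕ e))
      (λ e → toℕ-injective (trans (toℕ-fromℕ< (m%n<n (position a r c) n)) e))
    rowCount : ∀ r → length (filter (P? r) (map suc (upTo (lookup a r))))
                     ≡ ∑[ j < lookup a r ] δ (position a r (suc (toℕ j)))
    rowCount r = begin
      length (filter (P? r) (map suc (upTo (lookup a r))))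
        ≡⟨ cong (length ∘ filter (P? r)) (map-upTo suc (lookup a r)) ⟩
      length (filter (P? r) (applyUpTo suc (lookup a r)))
        ≡⟨ length-filter-applyUpTo (P? r) suc (lookup a r) ⟩
      ∑[ j < lookup a r ] ind (P? r (suc (toℕ j)))
        ≡⟨ ∑-cong (λ (j : Fin (lookup a r)) → δ-position r (suc (toℕ j))) ⟩
      ∑[ j < lookup a r ] δ (position a r (suc (toℕ j)))
        ∎

  U~-weight : wt a (U~ a) ≡ η n (sum a)
  U~-weight = tabulate-cong U~-count

proposition4p9 : (n : ℕ) .{{_ : NonZero n}} → 2 ≤ n → (a : WeakComp n) →
    SSKD a (U~ a) × wt a (U~ a) ≡ η n (sum a)
proposition4p9 n _ a = U~-SSKD a , U~-weight a
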